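{- Let $m,j,s,\alpha$ be integers with $1\le j\le m-1$, $0\le s\le m-j-1$ and $\alpha\ge0$. Then \[ \sum_{r=s}^{m-1}\binom{\alpha-r}{j}\,H(m,\alpha,r)\,H(m-j,r,s)=0. \]
   Context: For integers $x$ and $n\ge0$, $\binom{x}{n}:=x(x-1)\cdots(x-n+1)/n!$ (negative $x$ allowed). For integers $M\ge1$, $a$, and $0\le t\le M-1$, $H(M,a,t):=(-1)^{M+1+t}\binom{a-1-t}{M-1-t}\binom{a}{t}$. -}

module Defs where

open import Data.Nat as ℕ using (ℕ; zero; suc; _!)
open import Data.Nat.Properties using (_!≢0)
open import Data.Integer using (ℤ; +_; _+_; _-_; _*_; -_; 1ℤ; 0ℤ; _/ℕ_)
open import Data.Integer.Base using (-1ℤ)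

falling : ℤ → ℕ → ℤ
falling x zero    = 1ℤ
falling x (suc n) = falling x n * (x - + n)

-- generalized binomial coefficient  binom x n = x(x-1)...(x-n+1)/n!
-- (the division is exact; _/ℕ_ is integer division)
binom : ℤ → ℕ → ℤ
binom x n = (falling x n /ℕ (n !)) {{n !≢0}}

sgn : ℕ → ℤ
sgn zero    = 1ℤ
sgn (suc k) = - sgn k

H : ℕ → ℤ → ℕ → ℤ
H M a t = sgn (M ℕ.+ 1 ℕ.+ t) * binom (a - 1ℤ - + t) (M ℕ.∸ 1 ℕ.∸ t) * binom a t

sumFrom : ℕ → ℕ → (ℕ → ℤ) → ℤ
sumFrom s zero    f = 0ℤ
sumFrom s (suc k) f = f s + sumFrom (suc s) k f

-- Σ_{r=s}^{n} f r  (empty if n < s)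
sumRange : ℕ → ℕ → (ℕ → ℤ) → ℤ
sumRange s n f = sumFrom s (suc n ℕ.∸ s) f

-- Put r = s + k and m = 1 + j + s + d, so that c := m − 1 − s = d + j and d = m − j − 1 − s.
-- The reflection formula binom x n = (−1)ⁿ binom (n − 1 − x) n removes the signs from both
-- H factors, and the multinomial identity
--   binom x (s+k) · binom (s+k) s · binom (x−s−k) j = binom x s · binom (x−s) j · binom (x−s−j) k
-- turns the summand into a constant times binom A k · binom (k−1) d · binom B (c−k) with A + B = d < c.
-- By Vandermonde, Σₖ binom A k · binom k i · binom B (c−k) = binom A i · binom (d−i) (c−i) = 0
-- for i ≤ d, and Pascal's rule binom k (i+1) = binom (k−1) (i+1) + binom (k−1) i carries this
-- over to binom (k−1) i by induction on i.
-- As binom is defined by truncating division, k! · binom x k = falling x k has to be proved: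
-- by Pascal's rule in ℕ for x ≥ 0, and by reflecting the falling factorial for x < 0.

module Submission where

open import Defs
open import Data.Nat as ℕ using (ℕ; zero; suc; _≤_; _<_; _∸_; _!; z≤n; s≤s)
open import Data.Nat.Combinatorics using (_C_; nCk+nC[k+1]≡[n+1]C[k+1]; nCn≡1; k>n⇒nCk≡0)
open import Data.Nat.DivMod using (m*n/n≡m; m*n%n≡0)
import Data.Nat.Properties as ℕₚ
open import Data.Nat.Properties using (_!≢0)
open import Data.Integer as ℤ using (ℤ; +_; -[1+_]; _+_; _-_; _*_; -_; 0ℤ; 1ℤ; _/ℕ_)
import Data.Integer.Properties as ℤₚ
open import Data.Integer.Tactic.RingSolver using (solve-∀)
open import Data.Product using (∃-syntax; _,_)
open import Function using (_∘_)
open import Relation.Binary.PropositionalEquality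
open ≡-Reasoning
import Algebra.Properties.CommutativeSemigroup as CommSemigroupProperties

open CommSemigroupProperties ℤₚ.+-commutativeSemigroup using (interchange)
open CommSemigroupProperties ℤₚ.*-commutativeSemigroup using (x∙yz≈y∙xz)
open import Algebra.Properties.AbelianGroup ℤₚ.+-0-abelianGroup using (∙-cancelʳ)

∑ : ℕ → (ℕ → ℤ) → ℤ
∑ zero    f = 0ℤ
∑ (suc n) f = f 0 + ∑ n (f ∘ suc)

infix 5 ∑
syntax ∑ n (λ k → e) = ∑[ k < n ] e

∑-cong : ∀ n {f g : ℕ → ℤ} → (∀ k → k < n → f k ≡ g k) → ∑ n f ≡ ∑ n g
∑-cong zero    f≡g = refl
∑-cong (suc n) f≡g = cong₂ _+_ (f≡g 0 (s≤s z≤n)) (∑-cong n (λ k k<n → f≡g (suc k) (s≤s k<n)))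

∑-zero : ∀ n {f : ℕ → ℤ} → (∀ k → k < n → f k ≡ 0ℤ) → ∑ n f ≡ 0ℤ
∑-zero zero    f≡0 = refl
∑-zero (suc n) f≡0 = cong₂ _+_ (f≡0 0 (s≤s z≤n)) (∑-zero n (λ k k<n → f≡0 (suc k) (s≤s k<n)))

∑-distrib-+ : ∀ n (f g : ℕ → ℤ) → ∑[ k < n ] (f k + g k) ≡ ∑ n f + ∑ n g
∑-distrib-+ zero    f g = refl
∑-distrib-+ (suc n) f g = trans (cong (_+_ (f 0 + g 0)) (∑-distrib-+ n (f ∘ suc) (g ∘ suc)))
                                (interchange (f 0) (g 0) (∑ n (f ∘ suc)) (∑ n (g ∘ suc)))

*-distribˡ-∑ : ∀ n a (f : ℕ → ℤ) → a * ∑ n f ≡ ∑[ k < n ] (a * f k)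
*-distribˡ-∑ zero    a f = ℤₚ.*-zeroʳ a
*-distribˡ-∑ (suc n) a f = trans (ℤₚ.*-distribˡ-+ a (f 0) (∑ n (f ∘ suc)))
                                 (cong (_+_ (a * f 0)) (*-distribˡ-∑ n a (f ∘ suc)))

∑-split : ∀ a b (f : ℕ → ℤ) → ∑ (a ℕ.+ b) f ≡ ∑ a f + (∑[ k < b ] f (a ℕ.+ k))
∑-split zero    b f = sym (ℤₚ.+-identityˡ (∑ b f))
∑-split (suc a) b f = trans (cong (_+_ (f 0)) (∑-split a b (f ∘ suc))) (sym (ℤₚ.+-assoc (f 0) _ _))

sumFrom≡∑ : ∀ s n f → sumFrom s n f ≡ ∑[ k < n ] f (s ℕ.+ k)
sumFrom≡∑ s zero    f = refl
sumFrom≡∑ s (suc n) f =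
  cong₂ _+_ (cong f (sym (ℕₚ.+-identityʳ s)))
            (trans (sumFrom≡∑ (suc s) n f) (∑-cong n (λ k _ → cong f (sym (ℕₚ.+-suc s k)))))

falling-suc : ∀ x k → falling (ℤ.suc x) (suc k) ≡ ℤ.suc x * falling x k
falling-suc x zero    = base x
  where
  base : ∀ x → 1ℤ * (1ℤ + x - 0ℤ) ≡ (1ℤ + x) * 1ℤ
  base = solve-∀
falling-suc x (suc k) = begin
    falling (ℤ.suc x) (suc k) * (ℤ.suc x - + suc k)
  ≡⟨ cong (_* (ℤ.suc x - + suc k)) (falling-suc x k) ⟩
    ℤ.suc x * falling x k * (ℤ.suc x - + suc k)
  ≡⟨ step x (falling x k) (+ k) ⟩
    ℤ.suc x * (falling x k * (x - + k)) ∎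
  where
  step : ∀ x f k → (1ℤ + x) * f * (1ℤ + x - (1ℤ + k)) ≡ (1ℤ + x) * (f * (x - k))
  step = solve-∀

falling-+ : ∀ x i l → falling x (i ℕ.+ l) ≡ falling x i * falling (x - + i) l
falling-+ x i zero    rewrite ℕₚ.+-identityʳ i = sym (ℤₚ.*-identityʳ (falling x i))
falling-+ x i (suc l) rewrite ℕₚ.+-suc i l = begin
    falling x (i ℕ.+ l) * (x - + (i ℕ.+ l))
  ≡⟨ cong₂ (λ f y → f * (x - y)) (falling-+ x i l) (ℤₚ.pos-+ i l) ⟩
    falling x i * falling (x - + i) l * (x - (+ i + + l))
  ≡⟨ regroup (falling x i) (falling (x - + i) l) x (+ i) (+ l) ⟩
    falling x i * (falling (x - + i) l * (x - + i - + l)) ∎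
  where
  regroup : ∀ f g x i l → f * g * (x - (i + l)) ≡ f * (g * (x - i - l))
  regroup = solve-∀

falling-0 : ∀ k → falling 0ℤ (suc k) ≡ 0ℤ
falling-0 zero    = refl
falling-0 (suc k) = cong (_* (0ℤ - + suc k)) (falling-0 k)

falling-nat : ∀ n k → falling (+ n) k ≡ + (k !) * + (n C k)
falling-nat n       zero    = refl
falling-nat zero    (suc k) = begin
    falling 0ℤ (suc k)                ≡⟨ falling-0 k ⟩
    0ℤ                                ≡⟨ ℤₚ.*-zeroʳ (+ (suc k !)) ⟨
    + (suc k !) * 0ℤ                  ≡⟨ cong (λ b → + (suc k !) * + b) (k>n⇒nCk≡0 {0} {suc k} (s≤s z≤n)) ⟨
    + (suc k !) * + (0 C suc k)       ∎
falling-nat (suc n) (suc k) = begin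
    falling (+ suc n) (suc k)
  ≡⟨ falling-suc (+ n) k ⟩
    + suc n * falling (+ n) k
  ≡⟨ cong (+ suc n *_) (falling-nat n k) ⟩
    (1ℤ + + n) * (f * b₀)
  ≡⟨ split (+ n) K f b₀ ⟩
    (1ℤ + K) * f * b₀ + f * b₀ * (+ n - K)
  ≡⟨ cong (_+_ ((1ℤ + K) * f * b₀)) (trans (sym (cong (_* (+ n - K)) (falling-nat n k))) (falling-nat n (suc k))) ⟩
    (1ℤ + K) * f * b₀ + + (suc k !) * b₁
  ≡⟨ cong (λ g → g * b₀ + + (suc k !) * b₁) (sym (ℤₚ.pos-* (suc k) (k !))) ⟩
    + (suc k !) * b₀ + + (suc k !) * b₁
  ≡⟨ ℤₚ.*-distribˡ-+ (+ (suc k !)) b₀ b₁ ⟨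
    + (suc k !) * (b₀ + b₁)
  ≡⟨ cong (λ b → + (suc k !) * b) (trans (sym (ℤₚ.pos-+ (n C k) (n C suc k))) (cong +_ (nCk+nC[k+1]≡[n+1]C[k+1] n k))) ⟩
    + (suc k !) * + (suc n C suc k) ∎
  where
  K f b₀ b₁ : ℤ
  K = + k
  f = + (k !)
  b₀ = + (n C k)
  b₁ = + (n C suc k)
  split : ∀ n K f b → (1ℤ + n) * (f * b) ≡ (1ℤ + K) * f * b + f * b * (n - K)
  split = solve-∀

falling-reflect : ∀ n x → falling (+ n - 1ℤ - x) n ≡ sgn n * falling x n
falling-reflect zero    x = refl
falling-reflect (suc n) x = begin
    falling (+ suc n - 1ℤ - x) (suc n)
  ≡⟨ cong (λ z → falling z (suc n)) (shift (+ n) x) ⟩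
    falling (ℤ.suc y) (suc n)
  ≡⟨ falling-suc y n ⟩
    ℤ.suc y * falling y n
  ≡⟨ cong (_*_ (ℤ.suc y)) (falling-reflect n x) ⟩
    ℤ.suc y * (sgn n * falling x n)
  ≡⟨ regroup (+ n) x (sgn n) (falling x n) ⟩
    - sgn n * (falling x n * (x - + n)) ∎
  where
  y : ℤ
  y = + n - 1ℤ - x
  shift : ∀ n x → 1ℤ + n - 1ℤ - x ≡ 1ℤ + (n - 1ℤ - x)
  shift = solve-∀
  regroup : ∀ n x σ f → (1ℤ + (n - 1ℤ - x)) * (σ * f) ≡ - σ * (f * (x - n))
  regroup = solve-∀

factorial-∣-falling : ∀ x k → ∃[ q ] falling x k ≡ + (k !) * q
factorial-∣-falling (+ n)    k = + (n C k) , falling-nat n k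
factorial-∣-falling -[1+ n ] k = sgn k * + ((k ℕ.+ n) C k) , (begin
    falling -[1+ n ] k
  ≡⟨ cong (λ z → falling z k) (trans (cong (λ z → + k - 1ℤ - z) (ℤₚ.pos-+ k n)) (negate (+ k) (+ n))) ⟨
    falling (+ k - 1ℤ - + (k ℕ.+ n)) k
  ≡⟨ falling-reflect k (+ (k ℕ.+ n)) ⟩
    sgn k * falling (+ (k ℕ.+ n)) k
  ≡⟨ cong (_*_ (sgn k)) (falling-nat (k ℕ.+ n) k) ⟩
    sgn k * (+ (k !) * + ((k ℕ.+ n) C k))
  ≡⟨ x∙yz≈y∙xz (sgn k) (+ (k !)) _ ⟩
    + (k !) * (sgn k * + ((k ℕ.+ n) C k)) ∎)
  where
  negate : ∀ k n → k - 1ℤ - (k + n) ≡ - (1ℤ + n)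
  negate = solve-∀

n*i/ℕn≡i : ∀ n i .{{_ : ℕ.NonZero n}} → (+ n * i) /ℕ n ≡ i
n*i/ℕn≡i n@(suc _) (+ i) = begin
    (+ n * + i) /ℕ n    ≡⟨ cong (_/ℕ n) (ℤₚ.pos-* n i) ⟨
    + (n ℕ.* i ℕ./ n)   ≡⟨ cong (λ a → + (a ℕ./ n)) (ℕₚ.*-comm n i) ⟩
    + (i ℕ.* n ℕ./ n)   ≡⟨ cong +_ (m*n/n≡m i n) ⟩
    + i                 ∎
-- On a negative dividend _/ℕ_ branches on the remainder, which is 0 here.
n*i/ℕn≡i n@(suc _) -[1+ i ]
  rewrite trans (cong (ℕ._% n) (ℕₚ.*-comm n (suc i))) (m*n%n≡0 (suc i) n) =
  cong (-_ ∘ +_) (trans (cong (ℕ._/ n) (ℕₚ.*-comm n (suc i))) (m*n/n≡m (suc i) n))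

falling≡k!*binom : ∀ x k → falling x k ≡ + (k !) * binom x k
falling≡k!*binom x k with factorial-∣-falling x k
... | q , falling≡k!*q = begin
    falling x k                                   ≡⟨ falling≡k!*q ⟩
    + (k !) * q                                   ≡⟨ cong (_*_ (+ (k !))) (n*i/ℕn≡i (k !) q {{k !≢0}}) ⟨
    + (k !) * ((+ (k !) * q) /ℕ k !) {{k !≢0}}    ≡⟨ cong (λ f → + (k !) * (f /ℕ k !) {{k !≢0}}) falling≡k!*q ⟨
    + (k !) * binom x k                           ∎

*-cancelˡ-! : ∀ k {a b} → + (k !) * a ≡ + (k !) * b → a ≡ b
*-cancelˡ-! k {a} {b} = ℤₚ.*-cancelˡ-≡ (+ (k !)) a b {{k !≢0}}

binom-pascal : ∀ x k → binom (ℤ.suc x) (suc k) ≡ binom x (suc k) + binom x k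
binom-pascal x k = *-cancelˡ-! (suc k) (begin
    + (suc k !) * binom (ℤ.suc x) (suc k)
  ≡⟨ falling≡k!*binom (ℤ.suc x) (suc k) ⟨
    falling (ℤ.suc x) (suc k)
  ≡⟨ falling-suc x k ⟩
    ℤ.suc x * falling x k
  ≡⟨ split x (+ k) (falling x k) ⟩
    falling x k * (x - + k) + (1ℤ + + k) * falling x k
  ≡⟨ cong₂ _+_ (falling≡k!*binom x (suc k)) (cong (_*_ (1ℤ + + k)) (falling≡k!*binom x k)) ⟩
    + (suc k !) * binom x (suc k) + (1ℤ + + k) * (+ (k !) * binom x k)
  ≡⟨ cong (_+_ (+ (suc k !) * binom x (suc k))) (ℤₚ.*-assoc (1ℤ + + k) (+ (k !)) (binom x k)) ⟨
    + (suc k !) * binom x (suc k) + (1ℤ + + k) * + (k !) * binom x k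
  ≡⟨ cong (λ f → + (suc k !) * binom x (suc k) + f * binom x k) (ℤₚ.pos-* (suc k) (k !)) ⟨
    + (suc k !) * binom x (suc k) + + (suc k !) * binom x k
  ≡⟨ ℤₚ.*-distribˡ-+ (+ (suc k !)) (binom x (suc k)) (binom x k) ⟨
    + (suc k !) * (binom x (suc k) + binom x k) ∎)
  where
  split : ∀ x k f → (1ℤ + x) * f ≡ f * (x - k) + (1ℤ + k) * f
  split = solve-∀

binom-nat : ∀ n k → binom (+ n) k ≡ + (n C k)
binom-nat n k = *-cancelˡ-! k (trans (sym (falling≡k!*binom (+ n) k)) (falling-nat n k))

binom-diag : ∀ n → binom (+ n) n ≡ 1ℤ
binom-diag n = trans (binom-nat n n) (cong +_ (nCn≡1 n))

binom-< : ∀ {n k} → n < k → binom (+ n) k ≡ 0ℤ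
binom-< {n} {k} n<k = trans (binom-nat n k) (cong +_ (k>n⇒nCk≡0 n<k))

binom-reflect : ∀ n x → binom (+ n - 1ℤ - x) n ≡ sgn n * binom x n
binom-reflect n x = *-cancelˡ-! n (begin
    + (n !) * binom (+ n - 1ℤ - x) n  ≡⟨ falling≡k!*binom (+ n - 1ℤ - x) n ⟨
    falling (+ n - 1ℤ - x) n          ≡⟨ falling-reflect n x ⟩
    sgn n * falling x n               ≡⟨ cong (_*_ (sgn n)) (falling≡k!*binom x n) ⟩
    sgn n * (+ (n !) * binom x n)     ≡⟨ x∙yz≈y∙xz (sgn n) (+ (n !)) (binom x n) ⟩
    + (n !) * (sgn n * binom x n)     ∎)

k!*l!*binom*binom≡falling : ∀ x k l →
  + (k !) * (+ (l !) * (binom x k * binom (x - + k) l)) ≡ falling x (k ℕ.+ l)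
k!*l!*binom*binom≡falling x k l = begin
    + (k !) * (+ (l !) * (binom x k * binom (x - + k) l))
  ≡⟨ regroup (+ (k !)) (+ (l !)) (binom x k) (binom (x - + k) l) ⟩
    + (k !) * binom x k * (+ (l !) * binom (x - + k) l)
  ≡⟨ cong₂ _*_ (falling≡k!*binom x k) (falling≡k!*binom (x - + k) l) ⟨
    falling x k * falling (x - + k) l
  ≡⟨ falling-+ x k l ⟨
    falling x (k ℕ.+ l) ∎
  where
  regroup : ∀ a b c d → a * (b * (c * d)) ≡ a * c * (b * d)
  regroup = solve-∀

binom-trinomial-comm : ∀ x k l → binom x k * binom (x - + k) l ≡ binom x l * binom (x - + l) k
binom-trinomial-comm x k l = *-cancelˡ-! k (*-cancelˡ-! l (begin
    + (l !) * (+ (k !) * (binom x k * binom (x - + k) l))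
  ≡⟨ x∙yz≈y∙xz (+ (l !)) (+ (k !)) _ ⟩
    + (k !) * (+ (l !) * (binom x k * binom (x - + k) l))
  ≡⟨ k!*l!*binom*binom≡falling x k l ⟩
    falling x (k ℕ.+ l)
  ≡⟨ cong (falling x) (ℕₚ.+-comm k l) ⟩
    falling x (l ℕ.+ k)
  ≡⟨ k!*l!*binom*binom≡falling x l k ⟨
    + (l !) * (+ (k !) * (binom x l * binom (x - + l) k)) ∎))

+[m+n]-+m≡+n : ∀ m n → + (m ℕ.+ n) - + m ≡ + n
+[m+n]-+m≡+n m n = trans (cong (_- + m) (ℤₚ.pos-+ m n)) (cancel (+ m) (+ n))
  where
  cancel : ∀ m n → m + n - m ≡ n
  cancel = solve-∀

s!*k!*binom[s+k,s]≡[s+k]! : ∀ s k → + (s !) * (+ (k !) * binom (+ (s ℕ.+ k)) s) ≡ + ((s ℕ.+ k) !)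
s!*k!*binom[s+k,s]≡[s+k]! s k = begin
    + (s !) * (+ (k !) * binom (+ n) s)
  ≡⟨ cong (λ b → + (s !) * (+ (k !) * b)) (ℤₚ.*-identityʳ (binom (+ n) s)) ⟨
    + (s !) * (+ (k !) * (binom (+ n) s * 1ℤ))
  ≡⟨ cong (λ b → + (s !) * (+ (k !) * (binom (+ n) s * b))) (trans (cong (λ y → binom y k) (+[m+n]-+m≡+n s k)) (binom-diag k)) ⟨
    + (s !) * (+ (k !) * (binom (+ n) s * binom (+ n - + s) k))
  ≡⟨ k!*l!*binom*binom≡falling (+ n) s k ⟩
    falling (+ n) n
  ≡⟨ falling≡k!*binom (+ n) n ⟩
    + (n !) * binom (+ n) n
  ≡⟨ cong (_*_ (+ (n !))) (binom-diag n) ⟩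
    + (n !) * 1ℤ
  ≡⟨ ℤₚ.*-identityʳ (+ (n !)) ⟩
    + (n !) ∎
  where
  n : ℕ
  n = s ℕ.+ k

binom-revision : ∀ x s k → binom x (s ℕ.+ k) * binom (+ (s ℕ.+ k)) s ≡ binom x s * binom (x - + s) k
binom-revision x s k = *-cancelˡ-! k (*-cancelˡ-! s (begin
    + (s !) * (+ (k !) * (binom x n * binom (+ n) s))
  ≡⟨ regroup (+ (s !)) (+ (k !)) (binom x n) (binom (+ n) s) ⟩
    binom x n * (+ (s !) * (+ (k !) * binom (+ n) s))
  ≡⟨ cong (_*_ (binom x n)) (s!*k!*binom[s+k,s]≡[s+k]! s k) ⟩
    binom x n * + (n !)
  ≡⟨ ℤₚ.*-comm (binom x n) (+ (n !)) ⟩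
    + (n !) * binom x n
  ≡⟨ falling≡k!*binom x n ⟨
    falling x n
  ≡⟨ k!*l!*binom*binom≡falling x s k ⟨
    + (s !) * (+ (k !) * (binom x s * binom (x - + s) k)) ∎))
  where
  n : ℕ
  n = s ℕ.+ k
  regroup : ∀ a b c d → a * (b * (c * d)) ≡ c * (a * (b * d))
  regroup = solve-∀

ℤ-induction : (P : ℤ → Set) → P 0ℤ → (∀ x → P x → P (ℤ.suc x)) → (∀ x → P (ℤ.suc x) → P x) → ∀ x → P x
ℤ-induction P p₀ up down (+ zero)     = p₀
ℤ-induction P p₀ up down (+ suc n)    = up (+ n) (ℤ-induction P p₀ up down (+ n))
ℤ-induction P p₀ up down -[1+ zero ]  = down -[1+ zero ] p₀
ℤ-induction P p₀ up down -[1+ suc n ] = down -[1+ suc n ] (ℤ-induction P p₀ up down -[1+ n ])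

module _ (B : ℤ) where

  private
    convolution : ℤ → ℕ → ℤ
    convolution A c = ∑[ k < suc c ] binom A k * binom B (c ∸ k)

    convolution-pascal : ∀ A c → convolution (ℤ.suc A) (suc c) ≡ convolution A (suc c) + convolution A c
    convolution-pascal A c = begin
        1ℤ * binom B (suc c) + (∑[ k < suc c ] binom (ℤ.suc A) (suc k) * binom B (c ∸ k))
      ≡⟨ cong (_+_ (1ℤ * binom B (suc c))) (∑-cong (suc c) (λ k _ →
           trans (cong (_* binom B (c ∸ k)) (binom-pascal A k))
                 (ℤₚ.*-distribʳ-+ (binom B (c ∸ k)) (binom A (suc k)) (binom A k)))) ⟩
        1ℤ * binom B (suc c) + (∑[ k < suc c ] binom A (suc k) * binom B (c ∸ k) + binom A k * binom B (c ∸ k))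
      ≡⟨ cong (_+_ (1ℤ * binom B (suc c)))
              (∑-distrib-+ (suc c) (λ k → binom A (suc k) * binom B (c ∸ k)) (λ k → binom A k * binom B (c ∸ k))) ⟩
        1ℤ * binom B (suc c) + ((∑[ k < suc c ] binom A (suc k) * binom B (c ∸ k)) + convolution A c)
      ≡⟨ ℤₚ.+-assoc (1ℤ * binom B (suc c)) _ (convolution A c) ⟨
        convolution A (suc c) + convolution A c ∎

    Vandermonde : ℤ → Set
    Vandermonde A = ∀ c → convolution A c ≡ binom (A + B) c

    vandermonde-0 : Vandermonde 0ℤ
    vandermonde-0 c = begin
        1ℤ * binom B c + (∑[ k < c ] binom 0ℤ (suc k) * binom B (c ∸ suc k))
      ≡⟨ cong (_+_ (1ℤ * binom B c)) (∑-zero c (λ k _ → cong (_* binom B (c ∸ suc k)) (binom-< {0} {suc k} (s≤s z≤n)))) ⟩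
        1ℤ * binom B c + 0ℤ
      ≡⟨ ℤₚ.+-identityʳ (1ℤ * binom B c) ⟩
        1ℤ * binom B c
      ≡⟨ ℤₚ.*-identityˡ (binom B c) ⟩
        binom B c
      ≡⟨ cong (λ y → binom y c) (ℤₚ.+-identityˡ B) ⟨
        binom (0ℤ + B) c ∎

    vandermonde-suc : ∀ A → Vandermonde A → Vandermonde (ℤ.suc A)
    vandermonde-suc A ih zero    = refl
    vandermonde-suc A ih (suc c) = begin
        convolution (ℤ.suc A) (suc c)                 ≡⟨ convolution-pascal A c ⟩
        convolution A (suc c) + convolution A c       ≡⟨ cong₂ _+_ (ih (suc c)) (ih c) ⟩
        binom (A + B) (suc c) + binom (A + B) c       ≡⟨ binom-pascal (A + B) c ⟨
        binom (ℤ.suc (A + B)) (suc c)                 ≡⟨ cong (λ y → binom y (suc c)) (ℤₚ.+-assoc 1ℤ A B) ⟨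
        binom (ℤ.suc A + B) (suc c)                   ∎

    vandermonde-pred : ∀ A → Vandermonde (ℤ.suc A) → Vandermonde A
    vandermonde-pred A ih zero    = refl
    vandermonde-pred A ih (suc c) = ∙-cancelʳ (convolution A c) (convolution A (suc c)) (binom (A + B) (suc c)) (begin
        convolution A (suc c) + convolution A c       ≡⟨ convolution-pascal A c ⟨
        convolution (ℤ.suc A) (suc c)                 ≡⟨ ih (suc c) ⟩
        binom (ℤ.suc A + B) (suc c)                   ≡⟨ cong (λ y → binom y (suc c)) (ℤₚ.+-assoc 1ℤ A B) ⟩
        binom (ℤ.suc (A + B)) (suc c)                 ≡⟨ binom-pascal (A + B) c ⟩
        binom (A + B) (suc c) + binom (A + B) c       ≡⟨ cong (_+_ (binom (A + B) (suc c))) (vandermonde-pred A ih c) ⟨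
        binom (A + B) (suc c) + convolution A c       ∎)

  vandermonde : ∀ A c → ∑[ k < suc c ] binom A k * binom B (c ∸ k) ≡ binom (A + B) c
  vandermonde = ℤ-induction Vandermonde vandermonde-0 vandermonde-suc vandermonde-pred

vandermonde-marked : ∀ A B {c i} → i ≤ c →
  ∑[ k < suc c ] binom A k * binom (+ k) i * binom B (c ∸ k) ≡ binom A i * binom (A - + i + B) (c ∸ i)
vandermonde-marked A B {i = i} i≤c with ℕₚ.m≤n⇒∃[o]m+o≡n i≤c
... | e , refl = begin
    ∑ (suc (i ℕ.+ e)) F
  ≡⟨ cong (λ n → ∑ n F) (ℕₚ.+-suc i e) ⟨
    ∑ (i ℕ.+ suc e) F
  ≡⟨ ∑-split i (suc e) F ⟩
    ∑ i F + (∑[ l < suc e ] F (i ℕ.+ l))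
  ≡⟨ cong₂ _+_ (∑-zero i (λ _ → F-below)) (∑-cong (suc e) (λ l _ → F-above l)) ⟩
    0ℤ + (∑[ l < suc e ] binom A i * (binom (A - + i) l * binom B (e ∸ l)))
  ≡⟨ ℤₚ.+-identityˡ _ ⟩
    ∑[ l < suc e ] binom A i * (binom (A - + i) l * binom B (e ∸ l))
  ≡⟨ *-distribˡ-∑ (suc e) (binom A i) (λ l → binom (A - + i) l * binom B (e ∸ l)) ⟨
    binom A i * (∑[ l < suc e ] binom (A - + i) l * binom B (e ∸ l))
  ≡⟨ cong (_*_ (binom A i)) (vandermonde B (A - + i) e) ⟩
    binom A i * binom (A - + i + B) e
  ≡⟨ cong (λ n → binom A i * binom (A - + i + B) n) (ℕₚ.m+n∸m≡n i e) ⟨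
    binom A i * binom (A - + i + B) (i ℕ.+ e ∸ i) ∎
  where
  F : ℕ → ℤ
  F k = binom A k * binom (+ k) i * binom B (i ℕ.+ e ∸ k)
  F-below : ∀ {k} → k < i → F k ≡ 0ℤ
  F-below {k} k<i = begin
    binom A k * binom (+ k) i * binom B (i ℕ.+ e ∸ k)  ≡⟨ cong (λ b → binom A k * b * binom B (i ℕ.+ e ∸ k)) (binom-< k<i) ⟩
    binom A k * 0ℤ * binom B (i ℕ.+ e ∸ k)             ≡⟨ cong (_* binom B (i ℕ.+ e ∸ k)) (ℤₚ.*-zeroʳ (binom A k)) ⟩
    0ℤ                                                 ∎
  F-above : ∀ l → F (i ℕ.+ l) ≡ binom A i * (binom (A - + i) l * binom B (e ∸ l))
  F-above l = begin
    binom A (i ℕ.+ l) * binom (+ (i ℕ.+ l)) i * binom B (i ℕ.+ e ∸ (i ℕ.+ l))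
      ≡⟨ cong₂ _*_ (binom-revision A i l) (cong (binom B) (ℕₚ.[m+n]∸[m+o]≡n∸o i e l)) ⟩
    binom A i * binom (A - + i) l * binom B (e ∸ l)
      ≡⟨ ℤₚ.*-assoc (binom A i) (binom (A - + i) l) (binom B (e ∸ l)) ⟩
    binom A i * (binom (A - + i) l * binom B (e ∸ l)) ∎

module _ {A B : ℤ} {c d : ℕ} (A+B≡d : A + B ≡ + d) (d<c : d < c) where

  vandermonde-marked-vanishes : ∀ {i} → i ≤ d → ∑[ k < suc c ] binom A k * binom (+ k) i * binom B (c ∸ k) ≡ 0ℤ
  vandermonde-marked-vanishes {i} i≤d = begin
      ∑[ k < suc c ] binom A k * binom (+ k) i * binom B (c ∸ k)
    ≡⟨ vandermonde-marked A B (ℕₚ.≤-trans i≤d (ℕₚ.<⇒≤ d<c)) ⟩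
      binom A i * binom (A - + i + B) (c ∸ i)
    ≡⟨ cong (λ y → binom A i * binom y (c ∸ i)) A-i+B≡d∸i ⟩
      binom A i * binom (+ (d ∸ i)) (c ∸ i)
    ≡⟨ cong (_*_ (binom A i)) (binom-< (ℕₚ.∸-monoˡ-< d<c i≤d)) ⟩
      binom A i * 0ℤ
    ≡⟨ ℤₚ.*-zeroʳ (binom A i) ⟩
      0ℤ ∎
    where
    regroup : ∀ A B i → A - i + B ≡ A + B - i
    regroup = solve-∀
    A-i+B≡d∸i : A - + i + B ≡ + (d ∸ i)
    A-i+B≡d∸i = begin
      A - + i + B   ≡⟨ regroup A B (+ i) ⟩
      A + B - + i   ≡⟨ cong (_- + i) A+B≡d ⟩
      + d - + i     ≡⟨ ℤₚ.m-n≡m⊖n d i ⟩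
      d ℤ.⊖ i       ≡⟨ ℤₚ.⊖-≥ i≤d ⟩
      + (d ∸ i)     ∎

  vandermonde-shifted-vanishes : ∀ {i} → i ≤ d → ∑[ k < suc c ] binom A k * binom (+ k - 1ℤ) i * binom B (c ∸ k) ≡ 0ℤ
  vandermonde-shifted-vanishes {zero}  _   = vandermonde-marked-vanishes z≤n
  vandermonde-shifted-vanishes {suc i} i<d = begin
      shifted (suc i)
    ≡⟨ ℤₚ.+-identityʳ (shifted (suc i)) ⟨
      shifted (suc i) + 0ℤ
    ≡⟨ cong (_+_ (shifted (suc i))) (vandermonde-shifted-vanishes (ℕₚ.<⇒≤ i<d)) ⟨
      shifted (suc i) + shifted i
    ≡⟨ ∑-distrib-+ (suc c) (term (suc i)) (term i) ⟨
      ∑[ k < suc c ] (term (suc i) k + term i k)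
    ≡⟨ ∑-cong (suc c) (λ k _ → pascal k) ⟨
      ∑[ k < suc c ] binom A k * binom (+ k) (suc i) * binom B (c ∸ k)
    ≡⟨ vandermonde-marked-vanishes i<d ⟩
      0ℤ ∎
    where
    term : ℕ → ℕ → ℤ
    term i k = binom A k * binom (+ k - 1ℤ) i * binom B (c ∸ k)
    shifted : ℕ → ℤ
    shifted i = ∑ (suc c) (term i)
    distrib : ∀ a x y b → a * (x + y) * b ≡ a * x * b + a * y * b
    distrib = solve-∀
    unshift : ∀ k → 1ℤ + (k - 1ℤ) ≡ k
    unshift = solve-∀
    pascal : ∀ k → binom A k * binom (+ k) (suc i) * binom B (c ∸ k) ≡ term (suc i) k + term i k
    pascal k = begin
      binom A k * binom (+ k) (suc i) * binom B (c ∸ k)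
        ≡⟨ cong (λ y → binom A k * binom y (suc i) * binom B (c ∸ k)) (unshift (+ k)) ⟨
      binom A k * binom (ℤ.suc (+ k - 1ℤ)) (suc i) * binom B (c ∸ k)
        ≡⟨ cong (λ b → binom A k * b * binom B (c ∸ k)) (binom-pascal (+ k - 1ℤ) i) ⟩
      binom A k * (binom (+ k - 1ℤ) (suc i) + binom (+ k - 1ℤ) i) * binom B (c ∸ k)
        ≡⟨ distrib (binom A k) (binom (+ k - 1ℤ) (suc i)) (binom (+ k - 1ℤ) i) (binom B (c ∸ k)) ⟩
      term (suc i) k + term i k ∎

multinomial-swap : ∀ x s k j →
  binom x (s ℕ.+ k) * binom (+ (s ℕ.+ k)) s * binom (x - + (s ℕ.+ k)) j ≡
  binom x s * binom (x - + s) j * binom (x - + s - + j) k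
multinomial-swap x s k j = begin
    binom x (s ℕ.+ k) * binom (+ (s ℕ.+ k)) s * binom (x - + (s ℕ.+ k)) j
  ≡⟨ cong₂ _*_ (binom-revision x s k) (cong (λ y → binom y j) x-[s+k]≡x-s-k) ⟩
    binom x s * binom (x - + s) k * binom (x - + s - + k) j
  ≡⟨ ℤₚ.*-assoc (binom x s) (binom (x - + s) k) (binom (x - + s - + k) j) ⟩
    binom x s * (binom (x - + s) k * binom (x - + s - + k) j)
  ≡⟨ cong (_*_ (binom x s)) (binom-trinomial-comm (x - + s) k j) ⟩
    binom x s * (binom (x - + s) j * binom (x - + s - + j) k)
  ≡⟨ ℤₚ.*-assoc (binom x s) (binom (x - + s) j) (binom (x - + s - + j) k) ⟨
    binom x s * binom (x - + s) j * binom (x - + s - + j) k ∎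
  where
  minus-+ : ∀ x s k → x - (s + k) ≡ x - s - k
  minus-+ = solve-∀
  x-[s+k]≡x-s-k : x - + (s ℕ.+ k) ≡ x - + s - + k
  x-[s+k]≡x-s-k = trans (cong (_-_ x) (ℤₚ.pos-+ s k)) (minus-+ x (+ s) (+ k))

sgn-+ : ∀ m n → sgn (m ℕ.+ n) ≡ sgn m * sgn n
sgn-+ zero    n = sym (ℤₚ.*-identityˡ (sgn n))
sgn-+ (suc m) n = trans (cong -_ (sgn-+ m n)) (ℤₚ.neg-distribˡ-* (sgn m) (sgn n))

sgn[n+n]≡1 : ∀ n → sgn (n ℕ.+ n) ≡ 1ℤ
sgn[n+n]≡1 zero    = refl
sgn[n+n]≡1 (suc n) = begin
    - sgn (n ℕ.+ suc n)      ≡⟨ cong (-_ ∘ sgn) (ℕₚ.+-suc n n) ⟩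
    - - sgn (n ℕ.+ n)        ≡⟨ ℤₚ.neg-involutive (sgn (n ℕ.+ n)) ⟩
    sgn (n ℕ.+ n)            ≡⟨ sgn[n+n]≡1 n ⟩
    1ℤ                       ∎

H-unsigned : ∀ {T} t n a → t ℕ.+ n ≡ T → H (suc T) a t ≡ binom (+ T - a) n * binom a t
H-unsigned t n a refl = begin
    σ * binom (a - 1ℤ - + t) (t ℕ.+ n ∸ t) * binom a t
  ≡⟨ cong (λ i → σ * binom (a - 1ℤ - + t) i * binom a t) (ℕₚ.m+n∸m≡n t n) ⟩
    σ * binom (a - 1ℤ - + t) n * binom a t
  ≡⟨ cong (λ y → σ * binom y n * binom a t) reflected ⟩
    σ * binom (+ n - 1ℤ - x) n * binom a t
  ≡⟨ cong (λ b → σ * b * binom a t) (binom-reflect n x) ⟩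
    σ * (sgn n * binom x n) * binom a t
  ≡⟨ cong (_* binom a t) (ℤₚ.*-assoc σ (sgn n) (binom x n)) ⟨
    σ * sgn n * binom x n * binom a t
  ≡⟨ cong (λ τ → τ * binom x n * binom a t) σ*sgn[n]≡1 ⟩
    1ℤ * binom x n * binom a t
  ≡⟨ cong (_* binom a t) (ℤₚ.*-identityˡ (binom x n)) ⟩
    binom x n * binom a t ∎
  where
  M : ℕ
  M = suc (t ℕ.+ n)
  σ x : ℤ
  σ = sgn (M ℕ.+ 1 ℕ.+ t)
  x = + (t ℕ.+ n) - a
  reflect : ∀ a t n → a - 1ℤ - t ≡ n - 1ℤ - (t + n - a)
  reflect = solve-∀
  reflected : a - 1ℤ - + t ≡ + n - 1ℤ - x
  reflected = trans (reflect a (+ t) (+ n)) (cong (λ y → + n - 1ℤ - (y - a)) (sym (ℤₚ.pos-+ t n)))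
  σ*sgn[n]≡1 : σ * sgn n ≡ 1ℤ
  σ*sgn[n]≡1 = begin
    σ * sgn n                   ≡⟨ sgn-+ (M ℕ.+ 1 ℕ.+ t) n ⟨
    sgn (M ℕ.+ 1 ℕ.+ t ℕ.+ n)   ≡⟨ cong sgn (trans (ℕₚ.+-assoc (M ℕ.+ 1) t n) (ℕₚ.+-assoc M 1 (t ℕ.+ n))) ⟩
    sgn (M ℕ.+ M)               ≡⟨ sgn[n+n]≡1 M ⟩
    1ℤ                          ∎

suc[m+n]∸m≡suc[n] : ∀ m n → suc (m ℕ.+ n) ∸ m ≡ suc n
suc[m+n]∸m≡suc[n] m n = trans (ℕₚ.+-∸-assoc 1 (ℕₚ.m≤m+n m n)) (cong suc (ℕₚ.m+n∸m≡n m n))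

module _ (α s d j : ℕ) where

  private
    c m : ℕ
    c = d ℕ.+ j
    m = suc (j ℕ.+ (s ℕ.+ d))

    N A B K : ℤ
    N = + α - + s
    A = N - + j
    B = + (j ℕ.+ (s ℕ.+ d)) - + α
    K = binom (+ α) s * binom N j * sgn d

    summand : ℕ → ℤ
    summand r = binom (+ α - + r) j * H m (+ α) r * H (m ∸ j) (+ r) s

    j+[s+d]≡s+c : j ℕ.+ (s ℕ.+ d) ≡ s ℕ.+ c
    j+[s+d]≡s+c = trans (ℕₚ.+-comm j (s ℕ.+ d)) (ℕₚ.+-assoc s d j)

    A+B≡d : A + B ≡ + d
    A+B≡d = begin
        + α - + s - + j + (+ (j ℕ.+ (s ℕ.+ d)) - + α)
      ≡⟨ cong (λ y → + α - + s - + j + (y - + α)) (trans (ℤₚ.pos-+ j (s ℕ.+ d)) (cong (_+_ (+ j)) (ℤₚ.pos-+ s d))) ⟩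
        + α - + s - + j + (+ j + (+ s + + d) - + α)
      ≡⟨ cancel (+ α) (+ s) (+ j) (+ d) ⟩
        + d ∎
      where
      cancel : ∀ α s j d → α - s - j + (j + (s + d) - α) ≡ d
      cancel = solve-∀

    H-outer : ∀ {k} → k ≤ c → H m (+ α) (s ℕ.+ k) ≡ binom B (c ∸ k) * binom (+ α) (s ℕ.+ k)
    H-outer {k} k≤c = H-unsigned (s ℕ.+ k) (c ∸ k) (+ α) (begin
      s ℕ.+ k ℕ.+ (c ∸ k)   ≡⟨ ℕₚ.+-assoc s k (c ∸ k) ⟩
      s ℕ.+ (k ℕ.+ (c ∸ k)) ≡⟨ cong (s ℕ.+_) (ℕₚ.m+[n∸m]≡n k≤c) ⟩
      s ℕ.+ c               ≡⟨ j+[s+d]≡s+c ⟨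
      j ℕ.+ (s ℕ.+ d)       ∎)

    H-inner : ∀ k → H (m ∸ j) (+ (s ℕ.+ k)) s ≡ binom (+ (s ℕ.+ d) - + (s ℕ.+ k)) d * binom (+ (s ℕ.+ k)) s
    H-inner k = trans (cong (λ M → H M (+ (s ℕ.+ k)) s) (suc[m+n]∸m≡suc[n] j (s ℕ.+ d)))
                      (H-unsigned s d (+ (s ℕ.+ k)) refl)

    shifted-binom : ∀ k → binom (+ (s ℕ.+ d) - + (s ℕ.+ k)) d ≡ sgn d * binom (+ k - 1ℤ) d
    shifted-binom k = trans (cong (λ y → binom y d) argument) (binom-reflect d (+ k - 1ℤ))
      where
      cancel : ∀ s d k → s + d - (s + k) ≡ d - 1ℤ - (k - 1ℤ)
      cancel = solve-∀
      argument : + (s ℕ.+ d) - + (s ℕ.+ k) ≡ + d - 1ℤ - (+ k - 1ℤ)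
      argument = trans (cong₂ (λ x y → x - y) (ℤₚ.pos-+ s d) (ℤₚ.pos-+ s k)) (cancel (+ s) (+ d) (+ k))

    summand-factorises : ∀ {k} → k ≤ c →
      summand (s ℕ.+ k) ≡ K * (binom A k * binom (+ k - 1ℤ) d * binom B (c ∸ k))
    summand-factorises {k} k≤c = begin
        binom (+ α - + (s ℕ.+ k)) j * H m (+ α) (s ℕ.+ k) * H (m ∸ j) (+ (s ℕ.+ k)) s
      ≡⟨ cong₂ (λ h h′ → binom (+ α - + (s ℕ.+ k)) j * h * h′) (H-outer k≤c) (H-inner k) ⟩
        binom (+ α - + (s ℕ.+ k)) j * (binom B (c ∸ k) * binom (+ α) (s ℕ.+ k))
          * (binom (+ (s ℕ.+ d) - + (s ℕ.+ k)) d * binom (+ (s ℕ.+ k)) s)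
      ≡⟨ regroup₁ (binom (+ α - + (s ℕ.+ k)) j) (binom B (c ∸ k)) (binom (+ α) (s ℕ.+ k))
                  (binom (+ (s ℕ.+ d) - + (s ℕ.+ k)) d) (binom (+ (s ℕ.+ k)) s) ⟩
        binom (+ α) (s ℕ.+ k) * binom (+ (s ℕ.+ k)) s * binom (+ α - + (s ℕ.+ k)) j
          * (binom (+ (s ℕ.+ d) - + (s ℕ.+ k)) d * binom B (c ∸ k))
      ≡⟨ cong₂ (λ x y → x * (y * binom B (c ∸ k))) (multinomial-swap (+ α) s k j) (shifted-binom k) ⟩
        binom (+ α) s * binom N j * binom A k * (sgn d * binom (+ k - 1ℤ) d * binom B (c ∸ k))
      ≡⟨ regroup₂ (binom (+ α) s) (binom N j) (binom A k) (sgn d) (binom (+ k - 1ℤ) d) (binom B (c ∸ k)) ⟩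
        K * (binom A k * binom (+ k - 1ℤ) d * binom B (c ∸ k)) ∎
      where
      regroup₁ : ∀ x b p₁ e p₂ → x * (b * p₁) * (e * p₂) ≡ p₁ * p₂ * x * (e * b)
      regroup₁ = solve-∀
      regroup₂ : ∀ a b c σ e f → a * b * c * (σ * e * f) ≡ a * b * σ * (c * e * f)
      regroup₂ = solve-∀

  sum-vanishes : 1 ≤ j → sumRange s (m ∸ 1) summand ≡ 0ℤ
  sum-vanishes 1≤j = begin
      sumFrom s (suc (j ℕ.+ (s ℕ.+ d)) ∸ s) summand
    ≡⟨ cong (λ n → sumFrom s (suc n ∸ s) summand) j+[s+d]≡s+c ⟩
      sumFrom s (suc (s ℕ.+ c) ∸ s) summand
    ≡⟨ cong (λ n → sumFrom s n summand) (suc[m+n]∸m≡suc[n] s c) ⟩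
      sumFrom s (suc c) summand
    ≡⟨ sumFrom≡∑ s (suc c) summand ⟩
      ∑[ k < suc c ] summand (s ℕ.+ k)
    ≡⟨ ∑-cong (suc c) (λ _ k<1+c → summand-factorises (ℕₚ.≤-pred k<1+c)) ⟩
      ∑[ k < suc c ] K * (binom A k * binom (+ k - 1ℤ) d * binom B (c ∸ k))
    ≡⟨ *-distribˡ-∑ (suc c) K (λ k → binom A k * binom (+ k - 1ℤ) d * binom B (c ∸ k)) ⟨
      K * (∑[ k < suc c ] binom A k * binom (+ k - 1ℤ) d * binom B (c ∸ k))
    ≡⟨ cong (_*_ K) (vandermonde-shifted-vanishes A+B≡d (ℕₚ.m<m+n d 1≤j) ℕₚ.≤-refl) ⟩
      K * 0ℤ
    ≡⟨ ℤₚ.*-zeroʳ K ⟩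
      0ℤ ∎

proposition3p2 : (m j s α : ℕ) → 1 ≤ j → j ≤ m ∸ 1 → s ≤ m ∸ j ∸ 1 →
    sumRange s (m ∸ 1) (λ r → binom (+ α - + r) j * H m (+ α) r * H (m ∸ j) (+ r) s) ≡ 0ℤ
proposition3p2 zero    (suc j) s α _ () _
proposition3p2 (suc m) j s α 1≤j j≤m s≤m∸j∸1 with ℕₚ.m≤n⇒∃[o]m+o≡n j≤m
... | t , refl with ℕₚ.m≤n⇒∃[o]m+o≡n (subst (s ≤_) (cong (_∸ 1) (suc[m+n]∸m≡suc[n] j t)) s≤m∸j∸1)
...   | d , refl = sum-vanishes α s d j 1≤j
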